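{- The category $\mathbf{StGrphs}$ satisfies axioms (L1), (L3) and (L4), and does not satisfy axioms (L2), (L5) and (L6).
   Context: A (conceptual) graph $G$ consists of a set $P(G)$ of parts, a distinguished subset $V(G)\subseteq P(G)$ of vertices, and an incidence map $\partial_G:P(G)\to V(G)\underline{\times}V(G)$ into the set of unordered pairs of vertices (the pair of $u,v$ written $u\_v$; $u=v$ allowed), such that $\partial_G(v)=v\_v$ for every vertex $v$. The edges are $E(G)=P(G)\setminus V(G)$; an edge with incidence $u\_u$ is a loop. Sets may be infinite; multiple edges and loops are allowed; the empty graph is allowed. A strict graph morphism $f:G\to H$ is a function $f:P(G)\to P(H)$ with $f(V(G))\subseteq V(H)$ and $f(E(G))\subseteq E(H)$ such that $\partial_H(f(e))=f(x)\_f(y)$ whenever $\partial_G(e)=x\_y$. $\mathbf{StGrphs}$ is the category whose objects are all such graphs and whose morphisms are the strict graph morphisms. The axioms, for a category $\mathcal{C}$: (L1) $\mathcal{C}$ has all finite limits and all finite colimits. (L2) $\mathcal{C}$ has a terminal object, binary products, and for all objects $A,B$ an object $B^A$ with $ev:B^A\times A\to B$ such that for every $X$ and $g:X\times A\to B$ there is a unique $\bar g:X\to B^A$ with $ev\circ(\bar g\times 1_A)=g$. (L3) $\mathcal{C}$ has a subobject classifier: a terminal object $\hat 1$ and $\top:\hat1\to\Omega$ such that for every monomorphism $m:S\to X$ there is a unique $\chi:X\to\Omega$ with $m$ a pullback of $\top$ along $\chi$. (L4) $\mathcal{C}$ has a natural number object: $\hat1$, $N$, $0:\hat1\to N$, $\sigma:N\to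 N$ such that for all $X$, $x:\hat1\to X$, $f:X\to X$ there is a unique $h:N\to X$ with $h0=x$, $h\sigma=fh$. (L5) For every morphism $f:A\to B$ with $A$ not initial there is $g:B\to A$ with $fgf=f$. (L6) $\mathcal{C}$ has a subobject classifier $\top:\hat1\to\Omega$ with $\Omega\cong\hat1+\hat1$. -}

module Defs where

open import Level using (Level; _⊔_) renaming (suc to lsuc)
open import Data.Nat using (ℕ)
open import Data.Fin using (Fin)
open import Data.Product using (Σ; Σ-syntax; _×_; _,_; proj₁; proj₂)
open import Data.Sum using (_⊎_; inj₁; inj₂)
open import Relation.Binary using (Rel; IsEquivalence; Setoid)
open import Relation.Nullary using (¬_)
open import Function.Bundles using (Func)

-- Categories (hom-sets carry an equivalence relation _≈_, i.e. equality
-- of morphisms; this is needed since Agda has no function extensionality)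

record Category (o ℓ e : Level) : Set (lsuc (o ⊔ ℓ ⊔ e)) where
  infixr 9 _∘_
  infix 4 _≈_
  field
    Obj : Set o
    _⇒_ : Obj → Obj → Set ℓ
    _≈_ : ∀ {A B} → Rel (A ⇒ B) e
    id  : ∀ {A} → A ⇒ A
    _∘_ : ∀ {A B C} → B ⇒ C → A ⇒ B → A ⇒ C
    ≈-isEquivalence : ∀ {A B} → IsEquivalence (_≈_ {A} {B})
    ∘-resp-≈ : ∀ {A B C} {f f' : B ⇒ C} {g g' : A ⇒ B} →
               f ≈ f' → g ≈ g' → f ∘ g ≈ f' ∘ g'
    assoc     : ∀ {A B C D} (f : C ⇒ D) (g : B ⇒ C) (h : A ⇒ B) →
                (f ∘ g) ∘ h ≈ f ∘ (g ∘ h)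
    identityˡ : ∀ {A B} (f : A ⇒ B) → id ∘ f ≈ f
    identityʳ : ∀ {A B} (f : A ⇒ B) → f ∘ id ≈ f

module Axioms {o ℓ e} (𝒞 : Category o ℓ e) where
  open Category 𝒞

  IsTerminal : Obj → Set (o ⊔ ℓ ⊔ e)
  IsTerminal T = ((X : Obj) → X ⇒ T) × (∀ {X} (f g : X ⇒ T) → f ≈ g)

  IsInitial : Obj → Set (o ⊔ ℓ ⊔ e)
  IsInitial I = ((X : Obj) → I ⇒ X) × (∀ {X} (f g : I ⇒ X) → f ≈ g)

  -- Finite diagrams: finitely many objects and finitely many arrows
  -- between them (no commutativity imposed), as in the usual definition
  -- of (co)limits of finite diagrams.
  record Diagram : Set (o ⊔ ℓ) where
    field
      nObj nArr : ℕ
      obj : Fin nObj → Obj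
      src tgt : Fin nArr → Fin nObj
      arr : (a : Fin nArr) → obj (src a) ⇒ obj (tgt a)

  record Cone (D : Diagram) : Set (o ⊔ ℓ ⊔ e) where
    open Diagram D
    field
      apex : Obj
      leg : (i : Fin nObj) → apex ⇒ obj i
      commute : (a : Fin nArr) → arr a ∘ leg (src a) ≈ leg (tgt a)

  record Cocone (D : Diagram) : Set (o ⊔ ℓ ⊔ e) where
    open Diagram D
    field
      apex : Obj
      leg : (i : Fin nObj) → obj i ⇒ apex
      commute : (a : Fin nArr) → leg (tgt a) ∘ arr a ≈ leg (src a)

  IsLimit : {D : Diagram} → Cone D → Set (o ⊔ ℓ ⊔ e)
  IsLimit {D} L = (K : Cone D) →
    Σ[ u ∈ Cone.apex K ⇒ Cone.apex L ]
      ((∀ i → Cone.leg L i ∘ u ≈ Cone.leg K i) ×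
       (∀ v → (∀ i → Cone.leg L i ∘ v ≈ Cone.leg K i) → v ≈ u))

  IsColimit : {D : Diagram} → Cocone D → Set (o ⊔ ℓ ⊔ e)
  IsColimit {D} L = (K : Cocone D) →
    Σ[ u ∈ Cocone.apex L ⇒ Cocone.apex K ]
      ((∀ i → u ∘ Cocone.leg L i ≈ Cocone.leg K i) ×
       (∀ v → (∀ i → v ∘ Cocone.leg L i ≈ Cocone.leg K i) → v ≈ u))

  record Product (A B : Obj) : Set (o ⊔ ℓ ⊔ e) where
    field
      P  : Obj
      π₁ : P ⇒ A
      π₂ : P ⇒ B
      universal : ∀ {X} (f : X ⇒ A) (g : X ⇒ B) →
        Σ[ h ∈ X ⇒ P ] ((π₁ ∘ h ≈ f × π₂ ∘ h ≈ g) ×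
                        (∀ k → π₁ ∘ k ≈ f → π₂ ∘ k ≈ g → k ≈ h))
    ⟨_,_⟩ : ∀ {X} → X ⇒ A → X ⇒ B → X ⇒ P
    ⟨ f , g ⟩ = proj₁ (universal f g)

  record Coproduct (A B : Obj) : Set (o ⊔ ℓ ⊔ e) where
    field
      S  : Obj
      ι₁ : A ⇒ S
      ι₂ : B ⇒ S
      universal : ∀ {X} (f : A ⇒ X) (g : B ⇒ X) →
        Σ[ h ∈ S ⇒ X ] ((h ∘ ι₁ ≈ f × h ∘ ι₂ ≈ g) ×
                        (∀ k → k ∘ ι₁ ≈ f → k ∘ ι₂ ≈ g → k ≈ h))

  Iso : Obj → Obj → Set (ℓ ⊔ e)
  Iso A B = Σ[ f ∈ A ⇒ B ] Σ[ g ∈ B ⇒ A ] (g ∘ f ≈ id × f ∘ g ≈ id)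

  Mono : ∀ {A B} → A ⇒ B → Set (o ⊔ ℓ ⊔ e)
  Mono {A} m = ∀ {Z} (g h : Z ⇒ A) → m ∘ g ≈ m ∘ h → g ≈ h

  IsPullback : ∀ {P A B C} (f : A ⇒ C) (g : B ⇒ C) (p : P ⇒ A) (q : P ⇒ B) →
               Set (o ⊔ ℓ ⊔ e)
  IsPullback {P} {A} {B} f g p q =
    (f ∘ p ≈ g ∘ q) ×
    (∀ {X} (h : X ⇒ A) (k : X ⇒ B) → f ∘ h ≈ g ∘ k →
       Σ[ u ∈ X ⇒ P ] ((p ∘ u ≈ h × q ∘ u ≈ k) ×
                       (∀ v → p ∘ v ≈ h → q ∘ v ≈ k → v ≈ u)))

  IsSubobjectClassifier : (T : Obj) → IsTerminal T → (Ω : Obj) → T ⇒ Ω →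
                          Set (o ⊔ ℓ ⊔ e)
  IsSubobjectClassifier T term Ω true =
    ∀ {S X} (m : S ⇒ X) → Mono m →
      Σ[ χ ∈ X ⇒ Ω ] (IsPullback χ true m (proj₁ term S) ×
                      (∀ χ' → IsPullback χ' true m (proj₁ term S) → χ' ≈ χ))

  L1 : Set (o ⊔ ℓ ⊔ e)
  L1 = (∀ (D : Diagram) → Σ (Cone D) IsLimit) ×
       (∀ (D : Diagram) → Σ (Cocone D) IsColimit)

  L2 : Set (o ⊔ ℓ ⊔ e)
  L2 = Σ[ T ∈ Obj ] IsTerminal T ×
       Σ[ prod ∈ (∀ A B → Product A B) ]
         (∀ A B → Σ[ BA ∈ Obj ] Σ[ ev ∈ Product.P (prod BA A) ⇒ B ]
            (∀ X (g : Product.P (prod X A) ⇒ B) →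
               let _×1 : X ⇒ BA → Product.P (prod X A) ⇒ Product.P (prod BA A)
                   h ×1 = Product.⟨_,_⟩ (prod BA A) (h ∘ Product.π₁ (prod X A))
                                                    (id ∘ Product.π₂ (prod X A))
               in Σ[ ḡ ∈ X ⇒ BA ] (ev ∘ (ḡ ×1) ≈ g ×
                                  (∀ h → ev ∘ (h ×1) ≈ g → h ≈ ḡ))))

  L3 : Set (o ⊔ ℓ ⊔ e)
  L3 = Σ[ T ∈ Obj ] Σ[ term ∈ IsTerminal T ] Σ[ Ω ∈ Obj ] Σ[ true ∈ T ⇒ Ω ]
         IsSubobjectClassifier T term Ω true

  L4 : Set (o ⊔ ℓ ⊔ e)
  L4 = Σ[ T ∈ Obj ] IsTerminal T × Σ[ N ∈ Obj ] Σ[ z ∈ T ⇒ N ] Σ[ σ ∈ N ⇒ N ]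
         (∀ X (x : T ⇒ X) (f : X ⇒ X) →
            Σ[ h ∈ N ⇒ X ] ((h ∘ z ≈ x × h ∘ σ ≈ f ∘ h) ×
                            (∀ k → k ∘ z ≈ x → k ∘ σ ≈ f ∘ k → k ≈ h)))

  L5 : Set (o ⊔ ℓ ⊔ e)
  L5 = ∀ {A B} (f : A ⇒ B) → ¬ IsInitial A → Σ[ g ∈ B ⇒ A ] (f ∘ g ∘ f ≈ f)

  L6 : Set (o ⊔ ℓ ⊔ e)
  L6 = Σ[ T ∈ Obj ] Σ[ term ∈ IsTerminal T ] Σ[ Ω ∈ Obj ] Σ[ true ∈ T ⇒ Ω ]
         (IsSubobjectClassifier T term Ω true ×
          Σ[ cp ∈ Coproduct T T ] Iso Ω (Coproduct.S cp))

module _ {ℓ} (V : Setoid ℓ ℓ) where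
  open Setoid V

  -- (u , v) and (x , y) denote the same unordered pair u_v = x_y
  UEq : Carrier × Carrier → Carrier × Carrier → Set ℓ
  UEq (u , v) (x , y) = (u ≈ x × v ≈ y) ⊎ (u ≈ y × v ≈ x)

  UEq-refl : ∀ p → UEq p p
  UEq-refl (u , v) = inj₁ (refl , refl)

  UEq-sym : ∀ {p q} → UEq p q → UEq q p
  UEq-sym (inj₁ (a , b)) = inj₁ (sym a , sym b)
  UEq-sym (inj₂ (a , b)) = inj₂ (sym b , sym a)

  UEq-trans : ∀ {p q r} → UEq p q → UEq q r → UEq p r
  UEq-trans (inj₁ (a , b)) (inj₁ (c , d)) = inj₁ (trans a c , trans b d)
  UEq-trans (inj₁ (a , b)) (inj₂ (c , d)) = inj₂ (trans a c , trans b d)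
  UEq-trans (inj₂ (a , b)) (inj₁ (c , d)) = inj₂ (trans a d , trans b c)
  UEq-trans (inj₂ (a , b)) (inj₂ (c , d)) = inj₁ (trans a d , trans b c)

mapPair : ∀ {ℓ} {V W : Setoid ℓ ℓ} → Func V W →
          Setoid.Carrier V × Setoid.Carrier V → Setoid.Carrier W × Setoid.Carrier W
mapPair f (u , v) = (Func.to f u , Func.to f v)

UEq-map : ∀ {ℓ} {V W : Setoid ℓ ℓ} (f : Func V W) {p q} →
          UEq V p q → UEq W (mapPair f p) (mapPair f q)
UEq-map f (inj₁ (a , b)) = inj₁ (Func.cong f a , Func.cong f b)
UEq-map f (inj₂ (a , b)) = inj₂ (Func.cong f a , Func.cong f b)

-- Graphs (parts P(G) = V(G) ⊎ E(G); every vertex v has ∂ v = v_v, so only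
-- the incidence of edges is recorded) and strict graph morphisms.

record Graph (ℓ : Level) : Set (lsuc ℓ) where
  field
    V : Setoid ℓ ℓ
    E : Setoid ℓ ℓ
    ∂ : Setoid.Carrier E → Setoid.Carrier V × Setoid.Carrier V
    ∂-cong : ∀ {e e'} → Setoid._≈_ E e e' → UEq V (∂ e) (∂ e')

record StHom {ℓ} (G H : Graph ℓ) : Set ℓ where
  private
    module G = Graph G
    module H = Graph H
  field
    fV : Func G.V H.V
    fE : Func G.E H.E
    comm : ∀ e → UEq H.V (H.∂ (Func.to fE e)) (mapPair fV (G.∂ e))

StEq : ∀ {ℓ} {G H : Graph ℓ} → StHom G H → StHom G H → Set ℓ
StEq {G = G} {H} f g =
  (∀ v → Setoid._≈_ (Graph.V H) (Func.to (StHom.fV f) v) (Func.to (StHom.fV g) v)) ×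
  (∀ e → Setoid._≈_ (Graph.E H) (Func.to (StHom.fE f) e) (Func.to (StHom.fE g) e))

StId : ∀ {ℓ} {G : Graph ℓ} → StHom G G
StId {G = G} = record
  { fV = record { to = λ v → v ; cong = λ p → p }
  ; fE = record { to = λ e → e ; cong = λ p → p }
  ; comm = λ e → UEq-refl (Graph.V G) (Graph.∂ G e)
  }

StComp : ∀ {ℓ} {G H K : Graph ℓ} → StHom H K → StHom G H → StHom G K
StComp {G = G} {H} {K} g f = record
  { fV = record { to = λ v → Func.to (StHom.fV g) (Func.to (StHom.fV f) v)
                ; cong = λ p → Func.cong (StHom.fV g) (Func.cong (StHom.fV f) p) }
  ; fE = record { to = λ e → Func.to (StHom.fE g) (Func.to (StHom.fE f) e)
                ; cong = λ p → Func.cong (StHom.fE g) (Func.cong (StHom.fE f) p) }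
  ; comm = λ e → UEq-trans (Graph.V K)
                   (StHom.comm g (Func.to (StHom.fE f) e))
                   (UEq-map (StHom.fV g) (StHom.comm f e))
  }

StGrphs : (ℓ : Level) → Category (lsuc ℓ) ℓ ℓ
StGrphs ℓ = record
  { Obj = Graph ℓ
  ; _⇒_ = StHom
  ; _≈_ = StEq
  ; id = StId
  ; _∘_ = StComp
  ; ≈-isEquivalence = λ {G} {H} → record
      { refl = (λ v → Setoid.refl (Graph.V H)) , (λ e → Setoid.refl (Graph.E H))
      ; sym = λ (p , q) → (λ v → Setoid.sym (Graph.V H) (p v)) ,
                          (λ e → Setoid.sym (Graph.E H) (q e))
      ; trans = λ (p , q) (r , s) → (λ v → Setoid.trans (Graph.V H) (p v) (r v)) ,
                                    (λ e → Setoid.trans (Graph.E H) (q e) (s e))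
      }
  ; ∘-resp-≈ = λ {A} {B} {C} {f} {f'} {g} {g'} (p , q) (r , s) →
      (λ v → Setoid.trans (Graph.V C) (Func.cong (StHom.fV f) (r v)) (p _)) ,
      (λ e → Setoid.trans (Graph.E C) (Func.cong (StHom.fE f) (s e)) (q _))
  ; assoc = λ {D = D} f g h → (λ v → Setoid.refl (Graph.V D)) , (λ e → Setoid.refl (Graph.E D))
  ; identityˡ = λ {B = B} f → (λ v → Setoid.refl (Graph.V B)) , (λ e → Setoid.refl (Graph.E B))
  ; identityʳ = λ {B = B} f → (λ v → Setoid.refl (Graph.V B)) , (λ e → Setoid.refl (Graph.E B))
  }

-- Limits and colimits of graphs are computed separately on vertices and on
-- edges; an edge of a limit must also record its pair of ends.  With excluded
-- middle, the subobject classifier has vertices false and true, a loop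
-- "inside" at true, and an edge "outside b c" for every unordered pair of truth
-- values; the natural number object is ℕ with a loop at every vertex.
-- No exponential B^A exists for A the single edge and B two vertices joined by
-- two edges: the transpose ḡ of the parity map g : A × A ⇒ B cannot separate
-- the ends of A (point × A has no edges), so it factors through the terminal
-- graph 1, a loop; then g cannot separate the diagonal edge of A × A from the
-- antidiagonal one, although their parities differ.  L5 fails since 1 has a
-- loop and A has none, so there is no morphism 1 ⇒ A at all; L6 fails since
-- 1 + 1 has only loops while the classifier has an edge from false to true.

module Submission where

open import Defs
open import Level using (Level; Lift; lift; lower)
open import Data.Bool using (Bool; true; false; not; _xor_)
open import Data.Empty using (⊥; ⊥-elim)
open import Data.Fin using (Fin)
open import Data.Nat using (ℕ; zero; suc)
open import Data.Product using (Σ; Σ-syntax; _×_; _,_; proj₁; proj₂)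
open import Data.Product.Relation.Binary.Pointwise.NonDependent using (_×ₛ_)
open import Data.Sum using (_⊎_; inj₁; inj₂)
open import Data.Sum.Relation.Binary.Pointwise using (_⊎ₛ_; inj₁; inj₂)
open import Data.Unit using (⊤; tt)
open import Function.Bundles using (Func; mk⇔)
open import Function.Construct.Constant using () renaming (function to constₛ)
open import Relation.Binary using (Setoid)
import Relation.Binary.Construct.On as On
open import Relation.Binary.PropositionalEquality as ≡ using (_≡_; refl; setoid)
open import Relation.Nullary using (¬_; yes; no; does)
open import Relation.Nullary.Decidable using (dec-true; does-⇔)
open import Axiom.ExcludedMiddle using (ExcludedMiddle)

module HomReasoning {o ℓ e} (𝒞 : Category o ℓ e) where
  open Category 𝒞

  hom-setoid : Obj → Obj → Setoid ℓ e
  hom-setoid A B = record { Carrier = A ⇒ B ; _≈_ = _≈_ ; isEquivalence = ≈-isEquivalence }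

  module _ {A B : Obj} where
    open Setoid (hom-setoid A B) public
      using () renaming (refl to ≈-refl; sym to ≈-sym; trans to ≈-trans)
    open import Relation.Binary.Reasoning.Setoid (hom-setoid A B) public

module ProductProperties {o ℓ e} {𝒞 : Category o ℓ e} where
  open Category 𝒞
  open Axioms 𝒞
  open HomReasoning 𝒞

  module _ {A B : Obj} (p : Product A B) where
    open Product p

    π₁∘⟨⟩ : ∀ {X} {f : X ⇒ A} {g : X ⇒ B} → π₁ ∘ ⟨ f , g ⟩ ≈ f
    π₁∘⟨⟩ = proj₁ (proj₁ (proj₂ (universal _ _)))

    π₂∘⟨⟩ : ∀ {X} {f : X ⇒ A} {g : X ⇒ B} → π₂ ∘ ⟨ f , g ⟩ ≈ g
    π₂∘⟨⟩ = proj₂ (proj₁ (proj₂ (universal _ _)))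

    ⟨⟩-unique : ∀ {X} {f : X ⇒ A} {g : X ⇒ B} {k : X ⇒ P} →
                π₁ ∘ k ≈ f → π₂ ∘ k ≈ g → k ≈ ⟨ f , g ⟩
    ⟨⟩-unique = proj₂ (proj₂ (universal _ _)) _

    ⟨⟩-cong : ∀ {X} {f f' : X ⇒ A} {g g' : X ⇒ B} →
              f ≈ f' → g ≈ g' → ⟨ f , g ⟩ ≈ ⟨ f' , g' ⟩
    ⟨⟩-cong f≈f' g≈g' = ⟨⟩-unique (≈-trans π₁∘⟨⟩ f≈f') (≈-trans π₂∘⟨⟩ g≈g')

    ⟨⟩∘ : ∀ {X Y} {f : Y ⇒ A} {g : Y ⇒ B} {h : X ⇒ Y} →
          ⟨ f , g ⟩ ∘ h ≈ ⟨ f ∘ h , g ∘ h ⟩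
    ⟨⟩∘ {f = f} {g} {h} = ⟨⟩-unique
      (begin π₁ ∘ ⟨ f , g ⟩ ∘ h   ≈⟨ assoc _ _ _ ⟨
             (π₁ ∘ ⟨ f , g ⟩) ∘ h ≈⟨ ∘-resp-≈ π₁∘⟨⟩ ≈-refl ⟩
             f ∘ h                ∎)
      (begin π₂ ∘ ⟨ f , g ⟩ ∘ h   ≈⟨ assoc _ _ _ ⟨
             (π₂ ∘ ⟨ f , g ⟩) ∘ h ≈⟨ ∘-resp-≈ π₂∘⟨⟩ ≈-refl ⟩
             g ∘ h                ∎)

  -- h × 1_A exactly as written in Axioms.L2
  _×id[_,_] : ∀ {X Y A} → X ⇒ Y → (p : Product X A) (q : Product Y A) →
              Product.P p ⇒ Product.P q
  h ×id[ p , q ] = Product.⟨_,_⟩ q (h ∘ Product.π₁ p) (id ∘ Product.π₂ p)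

  module _ {X Y A : Obj} (p : Product X A) (q : Product Y A) where
    private
      module p = Product p
      module q = Product q

    ×id∘⟨⟩ : ∀ {Z} (h : X ⇒ Y) {f : Z ⇒ X} {g : Z ⇒ A} →
             h ×id[ p , q ] ∘ p.⟨ f , g ⟩ ≈ q.⟨ h ∘ f , g ⟩
    ×id∘⟨⟩ h {f} {g} = begin
      q.⟨ h ∘ p.π₁ , id ∘ p.π₂ ⟩ ∘ p.⟨ f , g ⟩
        ≈⟨ ⟨⟩∘ q ⟩
      q.⟨ (h ∘ p.π₁) ∘ p.⟨ f , g ⟩ , (id ∘ p.π₂) ∘ p.⟨ f , g ⟩ ⟩
        ≈⟨ ⟨⟩-cong q (≈-trans (assoc _ _ _) (∘-resp-≈ ≈-refl (π₁∘⟨⟩ p)))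
                     (≈-trans (assoc _ _ _) (≈-trans (identityˡ _) (π₂∘⟨⟩ p))) ⟩
      q.⟨ h ∘ f , g ⟩ ∎

    ×id-cong : ∀ {h h' : X ⇒ Y} → h ≈ h' → h ×id[ p , q ] ≈ h' ×id[ p , q ]
    ×id-cong h≈h' = ⟨⟩-cong q (∘-resp-≈ h≈h' ≈-refl) ≈-refl

  ×id-∘ : ∀ {X Y Z A} (p : Product X A) (q : Product Y A) (r : Product Z A)
          (h : Y ⇒ Z) (j : X ⇒ Y) →
          (h ∘ j) ×id[ p , r ] ≈ h ×id[ q , r ] ∘ j ×id[ p , q ]
  ×id-∘ p q r h j = ≈-sym (≈-trans (×id∘⟨⟩ q r h)
    (⟨⟩-cong r (≈-sym (assoc _ _ _)) ≈-refl))

  ×id-transpose : ∀ {X Y E A B} (p : Product X A) (q : Product Y A) (r : Product E A)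
                  {ev : Product.P r ⇒ B} {ḡ : Y ⇒ E} {g : Product.P q ⇒ B} (j : X ⇒ Y) →
                  ev ∘ ḡ ×id[ q , r ] ≈ g → ev ∘ (ḡ ∘ j) ×id[ p , r ] ≈ g ∘ j ×id[ p , q ]
  ×id-transpose p q r {ev} {ḡ} {g} j ev∘ḡ×id≈g = begin
    ev ∘ (ḡ ∘ j) ×id[ p , r ]                  ≈⟨ ∘-resp-≈ ≈-refl (×id-∘ p q r ḡ j) ⟩
    ev ∘ ḡ ×id[ q , r ] ∘ j ×id[ p , q ]       ≈⟨ assoc _ _ _ ⟨
    (ev ∘ ḡ ×id[ q , r ]) ∘ j ×id[ p , q ]     ≈⟨ ∘-resp-≈ ev∘ḡ×id≈g ≈-refl ⟩
    g ∘ j ×id[ p , q ]                         ∎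

  transpose-equalizes : ∀ {X Y E A B} (p : Product X A) (q : Product Y A) (r : Product E A)
    {ev : Product.P r ⇒ B} {ḡ : Y ⇒ E} {g : Product.P q ⇒ B} {t : X ⇒ E} (i₀ i₁ : X ⇒ Y) →
    (∀ h → ev ∘ h ×id[ p , r ] ≈ g ∘ i₀ ×id[ p , q ] → h ≈ t) →
    ev ∘ ḡ ×id[ q , r ] ≈ g → g ∘ i₀ ×id[ p , q ] ≈ g ∘ i₁ ×id[ p , q ] → ḡ ∘ i₀ ≈ ḡ ∘ i₁
  transpose-equalizes p q r i₀ i₁ unique ev∘ḡ×id≈g gi₀≈gi₁ =
    ≈-trans (unique _ (×id-transpose p q r i₀ ev∘ḡ×id≈g))
            (≈-sym (unique _ (≈-trans (×id-transpose p q r i₁ ev∘ḡ×id≈g) (≈-sym gi₀≈gi₁))))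

  factored-transpose : ∀ {A B E T} (p : Product A A) (q : Product T A) (r : Product E A)
    {ev : Product.P r ⇒ B} {ḡ : A ⇒ E} {g : Product.P p ⇒ B} (k : T ⇒ E) (t : A ⇒ T) (s : A ⇒ A) →
    ev ∘ ḡ ×id[ p , r ] ≈ g → ḡ ≈ k ∘ t → t ∘ s ≈ t →
    g ∘ Product.⟨_,_⟩ p id s ≈ (g ∘ Product.⟨_,_⟩ p id id) ∘ s
  factored-transpose p q r {ev} {ḡ} {g} k t s ev∘ḡ×id≈g ḡ≈kt ts≈t = begin
    g ∘ p.⟨ id , s ⟩                  ≈⟨ ∘-resp-≈ g≈Fτ ≈-refl ⟩
    (F ∘ τ) ∘ p.⟨ id , s ⟩            ≈⟨ assoc _ _ _ ⟩
    F ∘ τ ∘ p.⟨ id , s ⟩              ≈⟨ ∘-resp-≈ ≈-refl τ∘⟨id,s⟩ ⟩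
    F ∘ (τ ∘ p.⟨ id , id ⟩) ∘ s       ≈⟨ assoc _ _ _ ⟨
    (F ∘ τ ∘ p.⟨ id , id ⟩) ∘ s       ≈⟨ ∘-resp-≈ (assoc _ _ _) ≈-refl ⟨
    ((F ∘ τ) ∘ p.⟨ id , id ⟩) ∘ s     ≈⟨ ∘-resp-≈ (∘-resp-≈ g≈Fτ ≈-refl) ≈-refl ⟨
    (g ∘ p.⟨ id , id ⟩) ∘ s           ∎
    where
    module p = Product p
    module q = Product q
    F = ev ∘ k ×id[ q , r ]
    τ = t ×id[ p , q ]
    g≈Fτ : g ≈ F ∘ τ
    g≈Fτ = begin
      g                         ≈⟨ ev∘ḡ×id≈g ⟨
      ev ∘ ḡ ×id[ p , r ]       ≈⟨ ∘-resp-≈ ≈-refl (×id-cong p r ḡ≈kt) ⟩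
      ev ∘ (k ∘ t) ×id[ p , r ] ≈⟨ ∘-resp-≈ ≈-refl (×id-∘ p q r k t) ⟩
      ev ∘ k ×id[ q , r ] ∘ τ   ≈⟨ assoc _ _ _ ⟨
      F ∘ τ                     ∎
    τ∘⟨id,s⟩ : τ ∘ p.⟨ id , s ⟩ ≈ (τ ∘ p.⟨ id , id ⟩) ∘ s
    τ∘⟨id,s⟩ = begin
      τ ∘ p.⟨ id , s ⟩                 ≈⟨ ×id∘⟨⟩ p q t ⟩
      q.⟨ t ∘ id , s ⟩                 ≈⟨ ⟨⟩-cong q t∘id∘s≈t∘id (identityˡ s) ⟨
      q.⟨ (t ∘ id) ∘ s , id ∘ s ⟩      ≈⟨ ⟨⟩∘ q ⟨
      q.⟨ t ∘ id , id ⟩ ∘ s            ≈⟨ ∘-resp-≈ (×id∘⟨⟩ p q t) ≈-refl ⟨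
      (τ ∘ p.⟨ id , id ⟩) ∘ s          ∎
      where
      t∘id∘s≈t∘id : (t ∘ id) ∘ s ≈ t ∘ id
      t∘id∘s≈t∘id = ≈-trans (∘-resp-≈ (identityʳ t) ≈-refl) (≈-trans ts≈t (≈-sym (identityʳ t)))

module CoproductProperties {o ℓ e} {𝒞 : Category o ℓ e} where
  open Category 𝒞
  open Axioms 𝒞
  open HomReasoning 𝒞

  module _ {A B : Obj} (c : Coproduct A B) where
    open Coproduct c

    copair-retract : ∀ {D} {d₁ : A ⇒ D} {d₂ : B ⇒ D} {r : D ⇒ S} →
                     r ∘ d₁ ≈ ι₁ → r ∘ d₂ ≈ ι₂ → r ∘ proj₁ (universal d₁ d₂) ≈ id
    copair-retract {D} {d₁} {d₂} {r} rd₁≈ι₁ rd₂≈ι₂ =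
      ≈-trans (unique (r ∘ copair) (commutes copair-ι₁ rd₁≈ι₁) (commutes copair-ι₂ rd₂≈ι₂))
              (≈-sym (unique id (identityˡ ι₁) (identityˡ ι₂)))
      where
      copair = proj₁ (universal d₁ d₂)
      copair-ι₁ : copair ∘ ι₁ ≈ d₁
      copair-ι₁ = proj₁ (proj₁ (proj₂ (universal d₁ d₂)))
      copair-ι₂ : copair ∘ ι₂ ≈ d₂
      copair-ι₂ = proj₂ (proj₁ (proj₂ (universal d₁ d₂)))
      commutes : ∀ {X} {i : X ⇒ S} {d : X ⇒ D} → copair ∘ i ≈ d → r ∘ d ≈ i →
                 (r ∘ copair) ∘ i ≈ i
      commutes c≈d rd≈i = ≈-trans (assoc _ _ _) (≈-trans (∘-resp-≈ ≈-refl c≈d) rd≈i)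
      unique = proj₂ (proj₂ (universal ι₁ ι₂))

UEq-setoid : ∀ {ℓ} → Setoid ℓ ℓ → Setoid ℓ ℓ
UEq-setoid V = record
  { Carrier = Setoid.Carrier V × Setoid.Carrier V ; _≈_ = UEq V
  ; isEquivalence = record { refl = UEq-refl V _ ; sym = UEq-sym V ; trans = UEq-trans V } }

UEq-resp-diagonal : ∀ {ℓ} (S : Setoid ℓ ℓ) {a b c d} → UEq S (a , b) (c , d) →
           Setoid._≈_ S a b → Setoid._≈_ S c d
UEq-resp-diagonal S (inj₁ (a≈c , b≈d)) a≈b = trans (sym a≈c) (trans a≈b b≈d)
  where open Setoid S
UEq-resp-diagonal S (inj₂ (a≈d , b≈c)) a≈b = trans (sym b≈c) (trans (sym a≈b) a≈d)
  where open Setoid S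

UEq-diagonal : ∀ {ℓ} (S : Setoid ℓ ℓ) {a b c} → UEq S (a , a) (b , c) →
               Setoid._≈_ S a b × Setoid._≈_ S a c
UEq-diagonal S (inj₁ (a≈b , a≈c)) = a≈b , a≈c
UEq-diagonal S (inj₂ (a≈c , a≈b)) = a≈b , a≈c

module SetoidLimit {ℓ} {n m : ℕ} (X : Fin n → Setoid ℓ ℓ) (src tgt : Fin m → Fin n)
                   (f : (a : Fin m) → Func (X (src a)) (X (tgt a))) where
  private module X i = Setoid (X i)

  Compatible : ((i : Fin n) → X.Carrier i) → Set ℓ
  Compatible x = ∀ a → X._≈_ (tgt a) (Func.to (f a) (x (src a))) (x (tgt a))

  limit : Setoid ℓ ℓ
  limit = record
    { Carrier = Σ _ Compatible
    ; _≈_ = λ x y → ∀ i → X._≈_ i (proj₁ x i) (proj₁ y i)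
    ; isEquivalence = record { refl = λ i → X.refl i ; sym = λ x≈y i → X.sym i (x≈y i)
                             ; trans = λ x≈y y≈z i → X.trans i (x≈y i) (y≈z i) } }

  π : ∀ i → Func limit (X i)
  π i = record { to = λ x → proj₁ x i ; cong = λ x≈y → x≈y i }

  tuple : (Y : Setoid ℓ ℓ) (g : ∀ i → Func Y (X i)) →
          (∀ a y → X._≈_ (tgt a) (Func.to (f a) (Func.to (g (src a)) y)) (Func.to (g (tgt a)) y)) →
          Func Y limit
  tuple Y g g-compatible = record
    { to = λ y → (λ i → Func.to (g i) y) , (λ a → g-compatible a y)
    ; cong = λ y≈y' i → Func.cong (g i) y≈y' }

module SetoidColimit {ℓ} {n m : ℕ} (X : Fin n → Setoid ℓ ℓ) (src tgt : Fin m → Fin n)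
                     (f : (a : Fin m) → Func (X (src a)) (X (tgt a))) where
  private module X i = Setoid (X i)

  data _∼_ : Σ (Fin n) X.Carrier → Σ (Fin n) X.Carrier → Set ℓ where
    within : ∀ {i x y} → X._≈_ i x y → (i , x) ∼ (i , y)
    along : ∀ a x → (src a , x) ∼ (tgt a , Func.to (f a) x)
    ∼-sym : ∀ {p q} → p ∼ q → q ∼ p
    ∼-trans : ∀ {p q r} → p ∼ q → q ∼ r → p ∼ r

  colimit : Setoid ℓ ℓ
  colimit = record
    { Carrier = Σ (Fin n) X.Carrier ; _≈_ = _∼_
    ; isEquivalence = record { refl = within (X.refl _) ; sym = ∼-sym ; trans = ∼-trans } }

  ι : ∀ i → Func (X i) colimit
  ι i = record { to = i ,_ ; cong = within }

  module _ (Y : Setoid ℓ ℓ) (g : ∀ i → Func (X i) Y)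
           (g-compatible : ∀ a x → Setoid._≈_ Y (Func.to (g (tgt a)) (Func.to (f a) x))
                                                (Func.to (g (src a)) x)) where
    private module Y = Setoid Y

    copair-cong : ∀ {p q} → p ∼ q → Func.to (g (proj₁ p)) (proj₂ p) Y.≈ Func.to (g (proj₁ q)) (proj₂ q)
    copair-cong (within {i} x≈y) = Func.cong (g i) x≈y
    copair-cong (along a x) = Y.sym (g-compatible a x)
    copair-cong (∼-sym p∼q) = Y.sym (copair-cong p∼q)
    copair-cong (∼-trans p∼q q∼r) = Y.trans (copair-cong p∼q) (copair-cong q∼r)

    copair : Func colimit Y
    copair = record { to = λ (i , x) → Func.to (g i) x ; cong = copair-cong }

module _ {ℓ : Level} where

  Vert Edge : Graph ℓ → Set ℓ
  Vert G = Setoid.Carrier (Graph.V G)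
  Edge G = Setoid.Carrier (Graph.E G)

  onV : ∀ {G H : Graph ℓ} → StHom G H → Vert G → Vert H
  onV f = Func.to (StHom.fV f)

  onE : ∀ {G H : Graph ℓ} → StHom G H → Edge G → Edge H
  onE f = Func.to (StHom.fE f)

  IsLoop : (G : Graph ℓ) → Edge G → Set ℓ
  IsLoop G e = Setoid._≈_ (Graph.V G) (proj₁ (Graph.∂ G e)) (proj₂ (Graph.∂ G e))

  ≡-func : {A : Set ℓ} (S : Setoid ℓ ℓ) → (A → Setoid.Carrier S) → Func (setoid A) S
  ≡-func S f = record { to = f ; cong = λ { refl → Setoid.refl S } }

  loops : Set ℓ → Graph ℓ
  loops A = record { V = setoid A ; E = setoid A ; ∂ = λ a → a , a
                   ; ∂-cong = λ a≡b → inj₁ (a≡b , a≡b) }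

  bare : Set ℓ → Graph ℓ
  bare A = record { V = setoid A ; E = setoid (Lift ℓ ⊥) ; ∂ = λ ()
                  ; ∂-cong = λ { {()} } }

  parallel : Set ℓ → Graph ℓ
  parallel A = record { V = setoid (Lift ℓ Bool) ; E = setoid A
                      ; ∂ = λ _ → lift false , lift true
                      ; ∂-cong = λ _ → inj₁ (refl , refl) }

  𝟙 point ∅ edge : Graph ℓ
  𝟙 = loops (Lift ℓ ⊤)
  point = bare (Lift ℓ ⊤)
  ∅ = bare (Lift ℓ ⊥)
  edge = parallel (Lift ℓ ⊤)

  ! : (X : Graph ℓ) → StHom X 𝟙
  ! X = record { fV = constₛ _ _ (lift tt) ; fE = constₛ _ _ (lift tt)
               ; comm = λ _ → inj₁ (refl , refl) }

  𝟙-terminal : Axioms.IsTerminal (StGrphs ℓ) 𝟙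
  𝟙-terminal = ! , λ _ _ → (λ _ → refl) , (λ _ → refl)

  vertexAt : (X : Graph ℓ) → Vert X → StHom point X
  vertexAt X x = record { fV = constₛ _ _ x ; fE = record { to = λ () ; cong = λ { {()} } }
                        ; comm = λ () }

  edgeAt : (X : Graph ℓ) (e : Edge X) {a b : Vert X} →
           UEq (Graph.V X) (Graph.∂ X e) (a , b) → StHom edge X
  edgeAt X e {a} {b} ∂e≈ab = record
    { fV = ≡-func _ λ { (lift false) → a ; (lift true) → b }
    ; fE = constₛ _ _ e
    ; comm = λ _ → ∂e≈ab }

  hom-preserves-loops : ∀ {G H : Graph ℓ} (f : StHom G H) {e} →
                        IsLoop G e → IsLoop H (onE f e)
  hom-preserves-loops {H = H} f {e} loop =
    UEq-resp-diagonal (Graph.V H) (UEq-sym (Graph.V H) (StHom.comm f e)) (Func.cong (StHom.fV f) loop)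

  loops-retract : ∀ {X Y : Graph ℓ} (r : StHom X Y) (s : StHom Y X) →
                  StEq (StComp s r) StId → (∀ e → IsLoop Y e) → ∀ e → IsLoop X e
  loops-retract {X} r s sr≈id Y-loops e =
    UEq-resp-diagonal (Graph.V X) (Graph.∂-cong X (proj₂ sr≈id e)) (hom-preserves-loops s (Y-loops (onE r e)))

  edge-not-loop : ¬ IsLoop edge (lift tt)
  edge-not-loop ()

  edge-factors-through-𝟙 : ∀ {X : Graph ℓ} (f : StHom edge X) →
    Setoid._≈_ (Graph.V X) (onV f (lift false)) (onV f (lift true)) →
    Σ[ k ∈ StHom 𝟙 X ] StEq f (StComp k (! edge))
  edge-factors-through-𝟙 {X} f ends≈ = k , f≈k!
    where
    module XV = Setoid (Graph.V X)
    k : StHom 𝟙 X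
    k = record { fV = constₛ _ _ (onV f (lift false)) ; fE = constₛ _ _ (onE f (lift tt))
               ; comm = λ _ → UEq-trans (Graph.V X) (StHom.comm f (lift tt)) (inj₁ (XV.refl , XV.sym ends≈)) }
    f≈k! : StEq f (StComp k (! edge))
    f≈k! = (λ { (lift false) → XV.refl ; (lift true) → XV.sym ends≈ })
         , (λ { (lift tt) → Setoid.refl (Graph.E X) })

  point-subterminal : ∀ {Z : Graph ℓ} (g h : StHom Z point) → StEq g h
  point-subterminal g _ = (λ _ → refl) , (λ e → ⊥-elim (lower (onE g e)))

  loops-map : {A B : Set ℓ} → (A → B) → StHom (loops A) (loops B)
  loops-map f = record { fV = ≡-func _ f ; fE = ≡-func _ f ; comm = λ _ → inj₁ (refl , refl) }

  loops-copair : {A : Set ℓ} {X : Graph ℓ} → (A → StHom 𝟙 X) → StHom (loops A) X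
  loops-copair {X = X} x = record
    { fV = ≡-func _ λ a → onV (x a) (lift tt)
    ; fE = ≡-func _ λ a → onE (x a) (lift tt)
    ; comm = λ a → StHom.comm (x a) (lift tt) }

module _ {ℓ : Level} (D : Axioms.Diagram (StGrphs ℓ)) where
  open Axioms.Diagram D
  private
    module O i = Graph (obj i)
    module LV = SetoidLimit O.V src tgt (λ a → StHom.fV (arr a))
    module LE = SetoidLimit O.E src tgt (λ a → StHom.fE (arr a))

  -- The ends are recorded because the family of edges does not determine them:
  -- the two edges of edge × edge lie over the same pair of edges.
  record LimitEdge : Set ℓ where
    field
      edges : Setoid.Carrier LE.limit
      ends : Setoid.Carrier (UEq-setoid LV.limit)
      incident : ∀ i → UEq (O.V i) (O.∂ i (proj₁ edges i)) (proj₁ (proj₁ ends) i , proj₁ (proj₂ ends) i)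
  open LimitEdge

  limit-graph : Graph ℓ
  limit-graph = record
    { V = LV.limit
    ; E = On.setoid (LE.limit ×ₛ UEq-setoid LV.limit) (λ e → edges e , ends e)
    ; ∂ = ends
    ; ∂-cong = proj₂ }

  limit-cone : Axioms.Cone (StGrphs ℓ) D
  limit-cone = record
    { apex = limit-graph
    ; leg = λ i → record
        { fV = LV.π i
        ; fE = record { to = λ e → proj₁ (edges e) i ; cong = λ e≈e' → proj₁ e≈e' i }
        ; comm = λ e → incident e i }
    ; commute = λ a → (λ v → proj₂ v a) , (λ e → proj₂ (edges e) a) }

  limit-cone-isLimit : Axioms.IsLimit (StGrphs ℓ) limit-cone
  limit-cone-isLimit K =
    u , (λ i → (λ _ → Setoid.refl (O.V i)) , (λ _ → Setoid.refl (O.E i))) , u-unique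
    where
    open Axioms.Cone K renaming (leg to κ)
    module A = Graph apex
    uV : Func A.V LV.limit
    uV = LV.tuple A.V (λ i → StHom.fV (κ i)) (λ a → proj₁ (commute a))
    uE : Func A.E LE.limit
    uE = LE.tuple A.E (λ i → StHom.fE (κ i)) (λ a → proj₂ (commute a))
    u : StHom apex limit-graph
    u = record
      { fV = uV
      ; fE = record { to = λ e → record { edges = Func.to uE e ; ends = mapPair uV (A.∂ e)
                                        ; incident = λ i → StHom.comm (κ i) e }
                    ; cong = λ e≈e' → Func.cong uE e≈e' , UEq-map uV (A.∂-cong e≈e') }
      ; comm = λ e → UEq-refl LV.limit (mapPair uV (A.∂ e)) }
    u-unique : ∀ v → (∀ i → StEq (StComp (Axioms.Cone.leg limit-cone i) v) (κ i)) → StEq v u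
    u-unique v v-legs =
      onV-≈ , λ e → (λ i → proj₂ (v-legs i) e)
                  , UEq-trans LV.limit {ends (onE v e)} {mapPair (StHom.fV v) (A.∂ e)} {mapPair uV (A.∂ e)}
                      (StHom.comm v e) (inj₁ (onV-≈ _ , onV-≈ _))
      where
      onV-≈ : ∀ x → Setoid._≈_ LV.limit (onV v x) (Func.to uV x)
      onV-≈ x i = proj₁ (v-legs i) x

module _ {ℓ : Level} (D : Axioms.Diagram (StGrphs ℓ)) where
  open Axioms.Diagram D
  private
    module O i = Graph (obj i)
    module CV = SetoidColimit O.V src tgt (λ a → StHom.fV (arr a))
    module CE = SetoidColimit O.E src tgt (λ a → StHom.fE (arr a))

  colimit-∂ : Func CE.colimit (UEq-setoid CV.colimit)
  colimit-∂ = CE.copair (UEq-setoid CV.colimit) (λ i → ∂ᵢ i)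
    (λ a e → UEq-trans CV.colimit (UEq-map (CV.ι (tgt a)) (StHom.comm (arr a) e))
                                   (inj₁ (CV.∼-sym (CV.along a _) , CV.∼-sym (CV.along a _))))
    where
    ∂ᵢ : ∀ i → Func (O.E i) (UEq-setoid CV.colimit)
    ∂ᵢ i = record { to = λ e → mapPair (CV.ι i) (O.∂ i e)
                  ; cong = λ e≈e' → UEq-map (CV.ι i) (O.∂-cong i e≈e') }

  colimit-graph : Graph ℓ
  colimit-graph = record { V = CV.colimit ; E = CE.colimit
                         ; ∂ = Func.to colimit-∂ ; ∂-cong = Func.cong colimit-∂ }

  colimit-cocone : Axioms.Cocone (StGrphs ℓ) D
  colimit-cocone = record
    { apex = colimit-graph
    ; leg = λ i → record { fV = CV.ι i ; fE = CE.ι i ; comm = λ _ → UEq-refl CV.colimit _ }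
    ; commute = λ a → (λ v → CV.∼-sym (CV.along a v)) , (λ e → CE.∼-sym (CE.along a e)) }

  colimit-cocone-isColimit : Axioms.IsColimit (StGrphs ℓ) colimit-cocone
  colimit-cocone-isColimit K =
    u , (λ i → (λ _ → Setoid.refl A.V) , (λ _ → Setoid.refl A.E)) , u-unique
    where
    open Axioms.Cocone K renaming (leg to κ)
    module A = Graph apex
    u : StHom colimit-graph apex
    u = record { fV = CV.copair A.V (λ i → StHom.fV (κ i)) (λ a → proj₁ (commute a))
               ; fE = CE.copair A.E (λ i → StHom.fE (κ i)) (λ a → proj₂ (commute a))
               ; comm = λ (i , e) → StHom.comm (κ i) e }
    u-unique : ∀ v → (∀ i → StEq (StComp v (Axioms.Cocone.leg colimit-cocone i)) (κ i)) → StEq v u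
    u-unique v v-legs = (λ (i , x) → proj₁ (v-legs i) x) , (λ (i , e) → proj₂ (v-legs i) e)

L1-holds : ∀ {ℓ} → Axioms.L1 (StGrphs ℓ)
L1-holds = (λ D → limit-cone D , limit-cone-isLimit D)
         , (λ D → colimit-cocone D , colimit-cocone-isColimit D)

module _ {ℓ : Level} where
  open Axioms (StGrphs ℓ) using (Mono; IsPullback; L3)

  -- A vertex is true when it lies in the subgraph; an edge of the subgraph is
  -- classified by the loop inside, any other edge with ends classified b, c
  -- by the edge outside b c.
  Ω-edges : Setoid ℓ ℓ
  Ω-edges = setoid (Lift ℓ ⊤) ⊎ₛ UEq-setoid (setoid (Lift ℓ Bool))

  inside : Setoid.Carrier Ω-edges
  inside = inj₁ (lift tt)

  outside : Lift ℓ Bool → Lift ℓ Bool → Setoid.Carrier Ω-edges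
  outside b c = inj₂ (b , c)

  Ω-∂ : Setoid.Carrier Ω-edges → Lift ℓ Bool × Lift ℓ Bool
  Ω-∂ (inj₁ _) = lift true , lift true
  Ω-∂ (inj₂ bc) = bc

  Ωᴳ : Graph ℓ
  Ωᴳ = record
    { V = setoid (Lift ℓ Bool) ; E = Ω-edges ; ∂ = Ω-∂
    ; ∂-cong = λ { (inj₁ _) → UEq-refl (setoid (Lift ℓ Bool)) _ ; (inj₂ bc≈bc') → bc≈bc' } }

  trueᴳ : StHom 𝟙 Ωᴳ
  trueᴳ = record { fV = constₛ _ _ (lift true) ; fE = constₛ _ _ inside
                 ; comm = λ _ → inj₁ (refl , refl) }

  Ω-edge-cases : ∀ ω {b c} → UEq (setoid (Lift ℓ Bool)) (Ω-∂ ω) (b , c) →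
                 Setoid._≈_ Ω-edges ω inside ⊎ Setoid._≈_ Ω-edges ω (outside b c)
  Ω-edge-cases (inj₁ _) _ = inj₁ (inj₁ refl)
  Ω-edge-cases (inj₂ _) ∂ω≈bc = inj₂ (inj₂ ∂ω≈bc)

  module Image {S X : Graph ℓ} (m : StHom S X) where
    private
      module XV = Setoid (Graph.V X)
      module XE = Setoid (Graph.E X)

    InV : Vert X → Set ℓ
    InV x = Σ[ s ∈ Vert S ] onV m s XV.≈ x

    InE : Edge X → Set ℓ
    InE x = Σ[ s ∈ Edge S ] onE m s XE.≈ x

    InV-resp : ∀ {x y} → x XV.≈ y → InV x → InV y
    InV-resp x≈y (s , ms≈x) = s , XV.trans ms≈x x≈y

    InE-resp : ∀ {x y} → x XE.≈ y → InE x → InE y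
    InE-resp x≈y (s , ms≈x) = s , XE.trans ms≈x x≈y

  module MonoProperties {S X : Graph ℓ} {m : StHom S X} (m-mono : Mono m) where
    private
      module S = Graph S
      module X = Graph X
    open Image m

    injectiveᵥ : ∀ {s s'} → Setoid._≈_ X.V (onV m s) (onV m s') → Setoid._≈_ S.V s s'
    injectiveᵥ {s} {s'} ms≈ms' =
      proj₁ (m-mono (vertexAt S s) (vertexAt S s') ((λ _ → ms≈ms') , λ ())) (lift tt)

    injective-ends : ∀ {a b c d} → UEq X.V (onV m a , onV m b) (onV m c , onV m d) →
                     UEq S.V (a , b) (c , d)
    injective-ends (inj₁ (p , q)) = inj₁ (injectiveᵥ p , injectiveᵥ q)
    injective-ends (inj₂ (p , q)) = inj₂ (injectiveᵥ p , injectiveᵥ q)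

    injectiveₑ : ∀ {s s'} → Setoid._≈_ X.E (onE m s) (onE m s') → Setoid._≈_ S.E s s'
    injectiveₑ {s} {s'} ms≈ms' =
      proj₂ (m-mono (edgeAt S s (UEq-refl S.V _)) (edgeAt S s' ∂s'≈∂s)
                    ((λ _ → Setoid.refl X.V) , λ _ → ms≈ms')) (lift tt)
      where
      ∂s'≈∂s : UEq S.V (S.∂ s') (S.∂ s)
      ∂s'≈∂s = injective-ends (UEq-trans X.V (UEq-sym X.V (StHom.comm m s'))
                 (UEq-trans X.V (X.∂-cong (Setoid.sym X.E ms≈ms')) (StHom.comm m s)))

    factor : ∀ {Y} (h : StHom Y X) → (∀ y → InV (onV h y)) → (∀ y → InE (onE h y)) →
             Σ[ u ∈ StHom Y S ] StEq (StComp m u) h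
    factor {Y} h inV inE = u , (λ y → proj₂ (inV y)) , (λ y → proj₂ (inE y))
      where
      module Y = Graph Y
      through : ∀ (Z : Setoid ℓ ℓ) {z z' x x'} → Setoid._≈_ Z z x → Setoid._≈_ Z x x' →
                Setoid._≈_ Z z' x' → Setoid._≈_ Z z z'
      through Z z≈x x≈x' z'≈x' = Setoid.trans Z z≈x (Setoid.trans Z x≈x' (Setoid.sym Z z'≈x'))
      u : StHom Y S
      u = record
        { fV = record { to = λ y → proj₁ (inV y)
                      ; cong = λ {y} {y'} y≈y' → injectiveᵥ
                          (through X.V (proj₂ (inV y)) (Func.cong (StHom.fV h) y≈y') (proj₂ (inV y'))) }
        ; fE = record { to = λ y → proj₁ (inE y)
                      ; cong = λ {y} {y'} y≈y' → injectiveₑ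
                          (through X.E (proj₂ (inE y)) (Func.cong (StHom.fE h) y≈y') (proj₂ (inE y'))) }
        ; comm = λ y → injective-ends
            (UEq-trans X.V (UEq-sym X.V (StHom.comm m (proj₁ (inE y))))
            (UEq-trans X.V (X.∂-cong (proj₂ (inE y)))
            (UEq-trans X.V (StHom.comm h y)
              (inj₁ (Setoid.sym X.V (proj₂ (inV _)) , Setoid.sym X.V (proj₂ (inV _))))))) }

  module PullbackOfTrue {S X : Graph ℓ} {m : StHom S X} {χ : StHom X Ωᴳ}
                        (pullback : IsPullback χ trueᴳ m (! S)) where
    private
      module X = Graph X
      Bools = setoid (Lift ℓ Bool)
    open Image m

    reflectsᵥ : ∀ {x} → onV χ x ≡ lift true → InV x
    reflectsᵥ {x} χx≡true with proj₂ pullback (vertexAt X x) (! point) ((λ _ → χx≡true) , λ ())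
    ... | u , (mu≈x , _) , _ = onV u (lift tt) , proj₁ mu≈x (lift tt)

    reflectsₑ : ∀ {x} → Setoid._≈_ Ω-edges (onE χ x) inside → InE x
    reflectsₑ {x} χx≈inside
      with proj₂ pullback (edgeAt X x (UEq-refl X.V _)) (! edge)
             ((λ { (lift false) → ≡.sym (proj₁ ends-true) ; (lift true) → ≡.sym (proj₂ ends-true) })
             , λ _ → χx≈inside)
      where
      ends-true = UEq-diagonal Bools
        (UEq-trans Bools (UEq-sym Bools (Graph.∂-cong Ωᴳ χx≈inside)) (StHom.comm χ x))
    ... | u , (mu≈x , _) , _ = onE u (lift tt) , proj₂ mu≈x (lift tt)

  module Characteristic (em : ExcludedMiddle ℓ) {S X : Graph ℓ} {m : StHom S X}
                        (m-mono : Mono m) where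
    private
      module X = Graph X
      module XV = Setoid X.V
      module ΩE = Setoid Ω-edges
      Bools = setoid (Lift ℓ Bool)
    open Image m
    open MonoProperties {m = m} m-mono

    χᵥ : Vert X → Lift ℓ Bool
    χᵥ x = lift (does (em {InV x}))

    χᵥ-true : ∀ {x} → χᵥ x ≡ lift true → InV x
    χᵥ-true {x} with em {InV x}
    ... | yes x∈ = λ _ → x∈
    ... | no _ = λ ()

    χᵥ-func : Func X.V Bools
    χᵥ-func = record { to = χᵥ ; cong = λ x≈y → ≡.cong lift
      (does-⇔ (mk⇔ (InV-resp x≈y) (InV-resp (XV.sym x≈y))) em em) }

    ends-in-image : ∀ {x} → InE x → InV (proj₁ (X.∂ x)) × InV (proj₂ (X.∂ x))
    ends-in-image {x} (s , ms≈x)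
      with UEq-trans X.V (X.∂-cong (Setoid.sym X.E ms≈x)) (StHom.comm m s)
    ... | inj₁ (p , q) = (_ , XV.sym p) , (_ , XV.sym q)
    ... | inj₂ (p , q) = (_ , XV.sym p) , (_ , XV.sym q)

    χₑ : Edge X → ΩE.Carrier
    χₑ x with em {InE x}
    ... | yes _ = inside
    ... | no _ = outside (χᵥ (proj₁ (X.∂ x))) (χᵥ (proj₂ (X.∂ x)))

    χₑ-image : ∀ {x} → InE x → χₑ x ΩE.≈ inside
    χₑ-image {x} x∈ with em {InE x}
    ... | yes _ = ΩE.refl
    ... | no x∉ = ⊥-elim (x∉ x∈)

    χₑ-inside : ∀ {x} → χₑ x ΩE.≈ inside → InE x
    χₑ-inside {x} with em {InE x}
    ... | yes x∈ = λ _ → x∈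
    ... | no _ = λ ()

    χₑ-cong : ∀ {x y} → Setoid._≈_ X.E x y → χₑ x ΩE.≈ χₑ y
    χₑ-cong {x} {y} x≈y with em {InE x} | em {InE y}
    ... | yes _ | yes _ = ΩE.refl
    ... | yes x∈ | no y∉ = ⊥-elim (y∉ (InE-resp x≈y x∈))
    ... | no x∉ | yes y∈ = ⊥-elim (x∉ (InE-resp (Setoid.sym X.E x≈y) y∈))
    ... | no _ | no _ = inj₂ (UEq-map χᵥ-func (X.∂-cong x≈y))

    χ : StHom X Ωᴳ
    χ = record
      { fV = χᵥ-func
      ; fE = record { to = χₑ ; cong = χₑ-cong }
      ; comm = χₑ-comm }
      where
      χₑ-comm : ∀ x → UEq Bools (Ω-∂ (χₑ x)) (χᵥ (proj₁ (X.∂ x)) , χᵥ (proj₂ (X.∂ x)))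
      χₑ-comm x with em {InE x}
      ... | yes x∈ = inj₁ (≡.cong lift (≡.sym (dec-true em (proj₁ (ends-in-image x∈))))
                          , ≡.cong lift (≡.sym (dec-true em (proj₂ (ends-in-image x∈)))))
      ... | no _ = UEq-refl Bools _

    χ-pullback : IsPullback χ trueᴳ m (! S)
    χ-pullback = square , universal
      where
      square : StEq (StComp χ m) (StComp trueᴳ (! S))
      square = (λ s → ≡.cong lift (dec-true em (s , XV.refl)))
             , (λ s → χₑ-image (s , Setoid.refl X.E))
      universal : ∀ {Y} (h : StHom Y X) (k : StHom Y 𝟙) → StEq (StComp χ h) (StComp trueᴳ k) →
        Σ[ u ∈ StHom Y S ] ((StEq (StComp m u) h × StEq (StComp (! S) u) k) ×
                            (∀ v → StEq (StComp m v) h → StEq (StComp (! S) v) k → StEq v u))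
      universal h k (χh≈trueᵥ , χh≈trueₑ)
        with factor h (λ y → χᵥ-true (χh≈trueᵥ y)) (λ y → χₑ-inside (χh≈trueₑ y))
      ... | u , mu≈h = u , (mu≈h , proj₂ 𝟙-terminal (StComp (! S) u) k)
                     , λ v mv≈h _ → m-mono v u (≈-trans {i = StComp m v} {j = h} {k = StComp m u}
                                                  mv≈h (≈-sym {x = StComp m u} {y = h} mu≈h))
        where open HomReasoning (StGrphs ℓ)

    χ-unique : ∀ χ' → IsPullback χ' trueᴳ m (! S) → StEq χ' χ
    χ-unique χ' pullback = unique-onV , unique-onE
      where
      open PullbackOfTrue {m = m} {χ = χ'} pullback
      square = proj₁ pullback
      unique-onV : ∀ x → onV χ' x ≡ χᵥ x
      unique-onV x with em {InV x}
      ... | yes (s , ms≈x) = ≡.trans (Func.cong (StHom.fV χ') (XV.sym ms≈x)) (proj₁ square s)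
      ... | no x∉ with onV χ' x in χ'x≡
      ...   | lift false = refl
      ...   | lift true = ⊥-elim (x∉ (reflectsᵥ χ'x≡))
      unique-onE : ∀ x → onE χ' x ΩE.≈ χₑ x
      unique-onE x with em {InE x}
      ... | yes (s , ms≈x) = ΩE.trans (Func.cong (StHom.fE χ') (Setoid.sym X.E ms≈x)) (proj₂ square s)
      ... | no x∉ with Ω-edge-cases (onE χ' x)
                         (UEq-trans Bools (StHom.comm χ' x) (inj₁ (unique-onV _ , unique-onV _)))
      ...   | inj₁ χ'x≈inside = ⊥-elim (x∉ (reflectsₑ χ'x≈inside))
      ...   | inj₂ χ'x≈outside = χ'x≈outside

  L3-holds : ExcludedMiddle ℓ → L3
  L3-holds em = 𝟙 , 𝟙-terminal , Ωᴳ , trueᴳ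
              , λ m m-mono → let open Characteristic em {m = m} m-mono
                             in χ , χ-pullback , χ-unique

module _ {ℓ : Level} where
  ℕᴳ : Graph ℓ
  ℕᴳ = loops (Lift ℓ ℕ)

  zeroᴳ : StHom 𝟙 ℕᴳ
  zeroᴳ = loops-map λ _ → lift zero

  sucᴳ : StHom ℕᴳ ℕᴳ
  sucᴳ = loops-map λ n → lift (suc (lower n))

  module _ {X : Graph ℓ} (x : StHom 𝟙 X) (f : StHom X X) where
    private
      module XV = Setoid (Graph.V X)
      module XE = Setoid (Graph.E X)

    iterateAt : ℕ → StHom 𝟙 X
    iterateAt zero = x
    iterateAt (suc n) = StComp f (iterateAt n)

    iterate : StHom ℕᴳ X
    iterate = loops-copair λ n → iterateAt (lower n)

    iterate-zero : StEq (StComp iterate zeroᴳ) x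
    iterate-zero = (λ _ → XV.refl) , (λ _ → XE.refl)

    iterate-suc : StEq (StComp iterate sucᴳ) (StComp f iterate)
    iterate-suc = (λ _ → XV.refl) , (λ _ → XE.refl)

    iterate-unique : ∀ h → StEq (StComp h zeroᴳ) x → StEq (StComp h sucᴳ) (StComp f h) →
                     StEq h iterate
    iterate-unique h (h0≈x , h0≈xₑ) (hs≈fh , hs≈fhₑ) = (λ n → onV-≈ (lower n)) , (λ n → onE-≈ (lower n))
      where
      onV-≈ : ∀ n → onV h (lift n) XV.≈ onV (iterateAt n) (lift tt)
      onV-≈ zero = h0≈x (lift tt)
      onV-≈ (suc n) = XV.trans (hs≈fh (lift n)) (Func.cong (StHom.fV f) (onV-≈ n))
      onE-≈ : ∀ n → onE h (lift n) XE.≈ onE (iterateAt n) (lift tt)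
      onE-≈ zero = h0≈xₑ (lift tt)
      onE-≈ (suc n) = XE.trans (hs≈fhₑ (lift n)) (Func.cong (StHom.fE f) (onE-≈ n))

  L4-holds : Axioms.L4 (StGrphs ℓ)
  L4-holds = 𝟙 , 𝟙-terminal , ℕᴳ , zeroᴳ , sucᴳ
           , λ X x f → iterate x f , (iterate-zero x f , iterate-suc x f) , iterate-unique x f

xor-not-not : ∀ x y → not x xor not y ≡ x xor y
xor-not-not false false = refl
xor-not-not false true = refl
xor-not-not true false = refl
xor-not-not true true = refl

module _ {ℓ : Level} where
  open Axioms (StGrphs ℓ) using (Product; L2)
  open ProductProperties

  doubleEdge : Graph ℓ
  doubleEdge = parallel (Lift ℓ Bool)

  swap : StHom (edge {ℓ}) edge
  swap = record { fV = ≡-func _ λ b → lift (not (lower b)) ; fE = constₛ _ _ (lift tt)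
                ; comm = λ _ → inj₂ (refl , refl) }

  ends-flip : ∀ {Y : Graph ℓ} (f : StHom Y edge) e →
              lower (onV f (proj₂ (Graph.∂ Y e))) ≡ not (lower (onV f (proj₁ (Graph.∂ Y e))))
  ends-flip f e = flip (StHom.comm f e)
    where
    flip : ∀ {u v : Lift ℓ Bool} → UEq (setoid _) (lift false , lift true) (u , v) →
           lower v ≡ not (lower u)
    flip (inj₁ (refl , refl)) = refl
    flip (inj₂ (refl , refl)) = refl

  module Parity (E² : Product edge edge) where
    open Product E²
    private module P = Graph P

    parity : Vert P → Bool
    parity w = lower (onV π₁ w) xor lower (onV π₂ w)

    parity-cong : ∀ {w w'} → Setoid._≈_ P.V w w' → parity w ≡ parity w'
    parity-cong w≈w' = ≡.cong₂ (λ a b → lower a xor lower b)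
      (Func.cong (StHom.fV π₁) w≈w') (Func.cong (StHom.fV π₂) w≈w')

    parity-along : ∀ e → parity (proj₂ (P.∂ e)) ≡ parity (proj₁ (P.∂ e))
    parity-along e = ≡.trans (≡.cong₂ _xor_ (ends-flip π₁ e) (ends-flip π₂ e))
      (xor-not-not (lower (onV π₁ (proj₁ (P.∂ e)))) (lower (onV π₂ (proj₁ (P.∂ e)))))

    parityₑ : Edge P → Bool
    parityₑ e = parity (proj₁ (P.∂ e))

    parityₑ-ends : ∀ {e a b} → UEq P.V (P.∂ e) (a , b) → parityₑ e ≡ parity a
    parityₑ-ends (inj₁ (∂₁≈a , _)) = parity-cong ∂₁≈a
    parityₑ-ends {e} (inj₂ (_ , ∂₂≈a)) = ≡.trans (≡.sym (parity-along e)) (parity-cong ∂₂≈a)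

    parity-hom : StHom P doubleEdge
    parity-hom = record
      { fV = StHom.fV π₂
      ; fE = record { to = λ e → lift (parityₑ e)
                    ; cong = λ e≈e' → ≡.cong lift (parityₑ-ends (P.∂-cong e≈e')) }
      ; comm = StHom.comm π₂ }

    parity-⟨⟩ : (f g : StHom edge edge) →
                parityₑ (onE ⟨ f , g ⟩ (lift tt)) ≡ lower (onV f (lift false)) xor lower (onV g (lift false))
    parity-⟨⟩ f g = ≡.trans (parityₑ-ends (StHom.comm ⟨ f , g ⟩ (lift tt)))
      (≡.cong₂ (λ a b → lower a xor lower b) (proj₁ (π₁∘⟨⟩ E²) (lift false)) (proj₁ (π₂∘⟨⟩ E²) (lift false)))

  no-edges-over-point : ∀ {A} (p : Product point A) → Edge (Product.P p) → ⊥
  no-edges-over-point p e = lower (onE (Product.π₁ p) e)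

  ¬L2 : ¬ L2
  ¬L2 (_ , _ , prod , exponential) =
    true≢false (≡.trans (≡.sym (parity-⟨⟩ StId swap))
               (≡.trans (≡.cong lower g-antidiag≡g-diag) (parity-⟨⟩ StId StId)))
    where
    E² = prod edge edge
    point× = prod point edge
    open Parity E² using (parity-hom; parity-⟨⟩)
    Q = proj₁ (exponential edge doubleEdge)
    ev = proj₁ (proj₂ (exponential edge doubleEdge))
    transpose = proj₂ (proj₂ (exponential edge doubleEdge))
    g = parity-hom
    ḡ = proj₁ (transpose edge g)
    ev∘ḡ×id≈g = proj₁ (proj₂ (transpose edge g))
    i₀ i₁ : StHom point edge
    i₀ = vertexAt edge (lift false)
    i₁ = vertexAt edge (lift true)

    g∘i₀×id≈g∘i₁×id : StEq (StComp g (i₀ ×id[ point× , E² ])) (StComp g (i₁ ×id[ point× , E² ]))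
    g∘i₀×id≈g∘i₁×id = (λ w → ≡.trans (proj₁ (π₂∘⟨⟩ E²) w) (≡.sym (proj₁ (π₂∘⟨⟩ E²) w)))
                    , λ e → ⊥-elim (no-edges-over-point point× e)

    ḡ-ends : Setoid._≈_ (Graph.V Q) (onV ḡ (lift false)) (onV ḡ (lift true))
    ḡ-ends = proj₁ (transpose-equalizes point× E² (prod Q edge) {ev} {ḡ} {g}
                      {proj₁ (transpose point g₀)} i₀ i₁ (proj₂ (proj₂ (transpose point g₀)))
                      ev∘ḡ×id≈g g∘i₀×id≈g∘i₁×id) (lift tt)
      where g₀ = StComp g (i₀ ×id[ point× , E² ])

    g-antidiag≡g-diag : onE g (onE (Product.⟨_,_⟩ E² StId swap) (lift tt))
                      ≡ onE g (onE (Product.⟨_,_⟩ E² StId StId) (lift tt))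
    g-antidiag≡g-diag with edge-factors-through-𝟙 ḡ ḡ-ends
    ... | k , ḡ≈k! = proj₂ (factored-transpose E² (prod 𝟙 edge) (prod Q edge) {ev} {ḡ} {g}
                              k (! edge) swap ev∘ḡ×id≈g ḡ≈k!
                              (proj₂ 𝟙-terminal (StComp (! edge) swap) (! edge))) (lift tt)

    true≢false : ¬ (true ≡ false)
    true≢false ()

module _ {ℓ : Level} where
  edge-not-initial : ¬ Axioms.IsInitial (StGrphs ℓ) edge
  edge-not-initial (from-edge , _) = lower (onV (from-edge ∅) (lift false))

  ¬L5 : ¬ Axioms.L5 (StGrphs ℓ)
  ¬L5 l5 = edge-not-loop (hom-preserves-loops g {lift tt} refl)
    where g = proj₁ (l5 (! edge) edge-not-initial)

  module Terminal {T : Graph ℓ} (T-terminal : Axioms.IsTerminal (StGrphs ℓ) T) where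
    private
      module TV = Setoid (Graph.V T)
      module TE = Setoid (Graph.E T)
      unique = proj₂ T-terminal

    vertices-equal : ∀ v w → v TV.≈ w
    vertices-equal v w = proj₁ (unique (vertexAt T v) (vertexAt T w)) (lift tt)

    edges-equal : ∀ e e' → e TE.≈ e'
    edges-equal e e' =
      proj₂ (unique (edgeAt T e (UEq-refl (Graph.V T) _)) (edgeAt T e' (UEq-refl (Graph.V T) _))) (lift tt)

    -- T + T is isomorphic to loops Bool.
    sum-has-only-loops : (c : Axioms.Coproduct (StGrphs ℓ) T T) →
                         ∀ e → IsLoop (Axioms.Coproduct.S c) e
    sum-has-only-loops c = loops-retract collapse expand
      (copair-retract c {d₁ = constant (lift false)} {constant (lift true)} {expand}
                      (expand∘constant (lift false)) (expand∘constant (lift true)))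
      (λ _ → refl)
      where
      open Axioms.Coproduct c
      open CoproductProperties
      ι : Lift ℓ Bool → StHom T S
      ι (lift false) = ι₁
      ι (lift true) = ι₂
      constant : Lift ℓ Bool → StHom T (loops (Lift ℓ Bool))
      constant b = StComp (loops-map λ _ → b) (! T)
      collapse : StHom S (loops (Lift ℓ Bool))
      collapse = proj₁ (universal (constant (lift false)) (constant (lift true)))
      expand : StHom (loops (Lift ℓ Bool)) S
      expand = loops-copair λ b → StComp (ι b) (proj₁ T-terminal 𝟙)
      expand∘constant : ∀ b → StEq (StComp expand (constant b)) (ι b)
      expand∘constant b = (λ v → Func.cong (StHom.fV (ι b)) (vertices-equal _ v))
                        , (λ e → Func.cong (StHom.fE (ι b)) (edges-equal _ e))

  classifier-has-proper-edge : ∀ {T T-terminal Ω truth} →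
    Axioms.IsSubobjectClassifier (StGrphs ℓ) T T-terminal Ω truth → ¬ (∀ e → IsLoop Ω e)
  classifier-has-proper-edge {T} {T-terminal} {Ω} {truth} classify Ω-loops =
    χ₁≉t (ΩV.trans (ΩV.sym χ₀≈χ₁) χ₀≈t)
    where
    module ΩV = Setoid (Graph.V Ω)
    i₀ = vertexAt edge (lift false)
    !point = proj₁ T-terminal point
    χ = proj₁ (classify i₀ (λ g h _ → point-subterminal g h))
    pullback = proj₁ (proj₂ (classify i₀ (λ g h _ → point-subterminal g h)))
    t = onV truth (onV !point (lift tt))
    χ₀≈t : onV χ (lift false) ΩV.≈ t
    χ₀≈t = proj₁ (proj₁ pullback) (lift tt)
    χ₁≉t : ¬ (onV χ (lift true) ΩV.≈ t)
    χ₁≉t χ₁≈t with proj₂ pullback (vertexAt edge (lift true)) !point ((λ _ → χ₁≈t) , λ ())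
    ... | _ , ((i₀u≈i₁ , _) , _) with proj₁ i₀u≈i₁ (lift tt)
    ... | ()
    χ₀≈χ₁ : onV χ (lift false) ΩV.≈ onV χ (lift true)
    χ₀≈χ₁ = UEq-resp-diagonal (Graph.V Ω) (StHom.comm χ (lift tt)) (Ω-loops (onE χ (lift tt)))

  ¬L6 : ¬ Axioms.L6 (StGrphs ℓ)
  ¬L6 (T , T-terminal , Ω , truth , classify , T+T , φ , ψ , ψφ≈id , _) =
    classifier-has-proper-edge {T} {T-terminal} {Ω} {truth} classify
      (loops-retract φ ψ ψφ≈id (Terminal.sum-has-only-loops T-terminal T+T))

proposition3p4 : ∀ {ℓ : Level} → ExcludedMiddle ℓ →
    Axioms.L1 (StGrphs ℓ) × Axioms.L3 (StGrphs ℓ) × Axioms.L4 (StGrphs ℓ) ×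
    ¬ Axioms.L2 (StGrphs ℓ) × ¬ Axioms.L5 (StGrphs ℓ) × ¬ Axioms.L6 (StGrphs ℓ)
proposition3p4 em = L1-holds , L3-holds em , L4-holds , ¬L2 , ¬L5 , ¬L6
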